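{- For any $n\geq2$, $G_n\cap(W_{n-1}\times W_{n-1})=(N_{3,n-1}\times N_{3,n-1})\cdot\langle(a_1|_{T_{n-1}},a_1|_{T_{n-1}})\rangle$.
   Context: $T$ is the infinite rooted binary tree of finite words over $\{1,2\}$, $T_n$ the words of length $\le n$, $W=\mathrm{Aut}(T)$, $W_n=\mathrm{Aut}(T_n)$, $\pi_n:W\to W_n$ restriction, $x|_{T_n}=\pi_n(x)$. For $u,v\in W_{n-1}$, $(u,v)\in W_n$ acts by $1w\mapsto1u(w)$, $2w\mapsto2v(w)$; this identifies $W_{n-1}\times W_{n-1}$ with the subgroup of $W_n$ acting trivially on level $1$. $\sigma$ swaps the first letter; $(u,v)\sigma=(u,v)\circ\sigma$. $a_1,a_2,a_3\in W$ are defined by $a_1=(\mathrm{id},a_3)$, $a_2=(\mathrm{id},a_1)\sigma$, $a_3=(a_2,\mathrm{id})\sigma$; $G$ is the closed subgroup they generate and $G_n=\pi_n(G)$. $N_3$ is the normal closure in $G$ of the subgroup generated by $a_3$, and $N_{3,n}=\pi_n(N_3)$. -}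

module Defs where

open import Data.Nat using (ℕ; zero; suc)
open import Data.Integer using (ℤ; +_; -[1+_])
open import Data.Bool using (Bool; true; false; if_then_else_; _xor_)
open import Data.Unit using (⊤; tt)
open import Data.Product using (_×_; _,_; Σ; ∃; ∃-syntax)
open import Data.List using (List; []; _∷_; foldr)
open import Data.Fin using (Fin)
open import Relation.Binary.PropositionalEquality using (_≡_)

-- Words over {1,2}: letters 1 and 2 are encoded as Bool false / true.
Letter : Set
Letter = Bool

-- W n = Aut(T_n), via the standard wreath recursion:
--   W 0 is trivial; an element (u , v , s) of W (suc n) is (u,v) if s = false
--   and (u,v)σ = (u,v) ∘ σ if s = true, with u, v ∈ W n.
W : ℕ → Set
W zero    = ⊤
W (suc n) = W n × W n × Bool

-- The action on words of length ≤ n (words given as lists of letters;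
-- letters beyond depth n are left unchanged, they are not part of T_n).
act : (n : ℕ) → W n → List Letter → List Letter
act zero    _           w       = w
act (suc n) _           []      = []
act (suc n) (u , v , s) (x ∷ w) with x xor s
... | false = false ∷ act n u w
... | true  = true  ∷ act n v w

idW : (n : ℕ) → W n
idW zero    = tt
idW (suc n) = idW n , idW n , false

-- composition  (f ∘ g)(w) = f (g w)
comp : (n : ℕ) → W n → W n → W n
comp zero    _ _ = tt
comp (suc n) (u , v , s) (u' , v' , s') =
  comp n u (if s then v' else u') , comp n v (if s then u' else v') , (s xor s')

inv : (n : ℕ) → W n → W n
inv zero    _           = tt
inv (suc n) (u , v , false) = inv n u , inv n v , false
inv (suc n) (u , v , true)  = inv n v , inv n u , true

powℕ : (n : ℕ) → W n → ℕ → W n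
powℕ n g zero    = idW n
powℕ n g (suc k) = comp n g (powℕ n g k)

powℤ : (n : ℕ) → W n → ℤ → W n
powℤ n g (+ k)    = powℕ n g k
powℤ n g -[1+ k ] = inv n (powℕ n g (suc k))

a₁ a₂ a₃ : (n : ℕ) → W n
a₁ zero    = tt
a₁ (suc n) = idW n , a₃ n , false
a₂ zero    = tt
a₂ (suc n) = idW n , a₁ n , true
a₃ zero    = tt
a₃ (suc n) = a₂ n , idW n , true

gen : (n : ℕ) → Fin 3 → W n
gen n Fin.zero             = a₁ n
gen n (Fin.suc Fin.zero)   = a₂ n
gen n (Fin.suc (Fin.suc _)) = a₃ n

-- group words in the generators a₁,a₂,a₃ and their inverses (Bool = inverted?)
GWord : Set
GWord = List (Fin 3 × Bool)

evalW : (n : ℕ) → GWord → W n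
evalW n []              = idW n
evalW n ((i , b) ∷ ws)  =
  comp n (if b then inv n (gen n i) else gen n i) (evalW n ws)

-- G_n = π_n(G): restrictions of elements of the group generated by a₁,a₂,a₃
-- (the closure does not change the image in the finite group W n).
InG : (n : ℕ) → W n → Set
InG n x = ∃[ w ] evalW n w ≡ x

-- N_{3,n} = π_n(N_3): restrictions of products of conjugates g a₃^{±1} g⁻¹, g ∈ G
conjProd : (n : ℕ) → List (GWord × Bool) → W n
conjProd n = foldr step (idW n)
  where
  step : GWord × Bool → W n → W n
  step (g , b) acc =
    comp n (comp n (evalW n g)
                   (comp n (if b then inv n (a₃ n) else a₃ n) (inv n (evalW n g))))
           acc

InN3 : (n : ℕ) → W n → Set
InN3 n x = ∃[ l ] conjProd n l ≡ x

-- W_{n-1} × W_{n-1} ⊆ W_n (n = suc m): elements acting trivially on level 1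
InLevel1Stab : (m : ℕ) → W (suc m) → Set
InLevel1Stab m (u , v , s) = s ≡ false

InProd : (m : ℕ) → W (suc m) → Set
InProd m x =
  Σ (W m) λ p → Σ (W m) λ q → Σ ℤ λ k →
    InN3 m p × InN3 m q ×
    x ≡ comp (suc m) (p , q , false) (powℤ (suc m) (a₁ m , a₁ m , false) k)

-- Since a₁a₂a₃ = 1, modulo the normal subgroup N₃ of G_n the generator a₂ equals a₁⁻¹ and
-- a₃ equals 1, so G_n = N₃⟨a₁⟩.  Let H = (N₃ × N₃)⟨(a₁ , a₁)⟩ ⊆ G_{n+1}.  Left multiplication
-- by a₁ = (1 , a₃), a₂ = (1 , a₁)σ and a₃ = (a₂ , 1)σ maps H ∪ H a₂ into itself, hence
-- G_{n+1} ⊆ H ∪ H a₂, and the level-1 stabiliser part of G_{n+1} is H.  Conversely, (a₁ , a₁) = a₂²,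
-- and N₃ × 1 and 1 × N₃ lie in G_{n+1}: every g ∈ G_n lifts to some (h , g) ∈ G_{n+1}, whose
-- conjugate of (1 , a₃) is (1 , g a₃ g⁻¹), and conjugation by a₃ moves (1 , q) to (a₂ q a₂⁻¹ , 1).

module Submission where

open import Defs
open import Level using (0ℓ)
open import Data.Nat using (ℕ; zero; suc; _≤_)
open import Data.Bool using (Bool; true; false; if_then_else_)
open import Data.Integer as ℤ using (+_; -[1+_])
open import Data.Product using (_×_; _,_; Σ; ∃; proj₁; proj₂)
open import Data.List using ([]; _∷_; _++_)
open import Data.Fin using (Fin)
open import Function.Bundles using (_⇔_; mk⇔)
open import Algebra.Bundles using (Group)
import Algebra.Properties.Group as GroupProperties
open import Relation.Binary.Bundles using (Preorder)
import Relation.Binary.Reasoning.Preorder as PreorderReasoning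
open import Relation.Binary.PropositionalEquality
  using (_≡_; refl; sym; trans; cong; cong₂; subst; isEquivalence; module ≡-Reasoning)

comp-identityˡ : ∀ n x → comp n (idW n) x ≡ x
comp-identityˡ zero    _           = refl
comp-identityˡ (suc n) (u , v , _) rewrite comp-identityˡ n u | comp-identityˡ n v = refl

comp-identityʳ : ∀ n x → comp n x (idW n) ≡ x
comp-identityʳ zero    _               = refl
comp-identityʳ (suc n) (u , v , false) rewrite comp-identityʳ n u | comp-identityʳ n v = refl
comp-identityʳ (suc n) (u , v , true)  rewrite comp-identityʳ n u | comp-identityʳ n v = refl

comp-assoc : ∀ n x y z → comp n (comp n x y) z ≡ comp n x (comp n y z)
comp-assoc zero _ _ _ = refl
comp-assoc (suc n) (u , v , false) (u' , v' , false) (u'' , v'' , _)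
  rewrite comp-assoc n u u' u'' | comp-assoc n v v' v'' = refl
comp-assoc (suc n) (u , v , false) (u' , v' , true) (u'' , v'' , _)
  rewrite comp-assoc n u u' v'' | comp-assoc n v v' u'' = refl
comp-assoc (suc n) (u , v , true) (u' , v' , false) (u'' , v'' , _)
  rewrite comp-assoc n u v' v'' | comp-assoc n v u' u'' = refl
comp-assoc (suc n) (u , v , true) (u' , v' , true) (u'' , v'' , false)
  rewrite comp-assoc n u v' u'' | comp-assoc n v u' v'' = refl
comp-assoc (suc n) (u , v , true) (u' , v' , true) (u'' , v'' , true)
  rewrite comp-assoc n u v' u'' | comp-assoc n v u' v'' = refl

inv-inverseˡ : ∀ n x → comp n (inv n x) x ≡ idW n
inv-inverseˡ zero    _               = refl
inv-inverseˡ (suc n) (u , v , false) rewrite inv-inverseˡ n u | inv-inverseˡ n v = refl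
inv-inverseˡ (suc n) (u , v , true)  rewrite inv-inverseˡ n u | inv-inverseˡ n v = refl

inv-inverseʳ : ∀ n x → comp n x (inv n x) ≡ idW n
inv-inverseʳ zero    _               = refl
inv-inverseʳ (suc n) (u , v , false) rewrite inv-inverseʳ n u | inv-inverseʳ n v = refl
inv-inverseʳ (suc n) (u , v , true)  rewrite inv-inverseʳ n u | inv-inverseʳ n v = refl

W-group : ℕ → Group 0ℓ 0ℓ
W-group n = record
  { Carrier = W n ; _≈_ = _≡_ ; _∙_ = comp n ; ε = idW n ; _⁻¹ = inv n
  ; isGroup = record
    { isMonoid = record
      { isSemigroup = record
        { isMagma = record { isEquivalence = isEquivalence ; ∙-cong = cong₂ (comp n) }
        ; assoc = comp-assoc n }
      ; identity = comp-identityˡ n , comp-identityʳ n }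
    ; inverse = inv-inverseˡ n , inv-inverseʳ n
    ; ⁻¹-cong = cong (inv n) } }

a₁a₂a₃-relations : ∀ n →
  comp n (a₁ n) (comp n (a₂ n) (a₃ n)) ≡ idW n ×
  comp n (a₂ n) (comp n (a₃ n) (a₁ n)) ≡ idW n ×
  comp n (a₃ n) (comp n (a₁ n) (a₂ n)) ≡ idW n
a₁a₂a₃-relations zero = refl , refl , refl
a₁a₂a₃-relations (suc n) with a₁a₂a₃-relations n
... | r₁ , r₂ , r₃
  rewrite comp-identityˡ n (idW n) | comp-identityˡ n (idW n) | r₁ | r₂ | r₃ = refl , refl , refl

pattern i₁ = Fin.zero
pattern i₂ = Fin.suc Fin.zero
pattern i₃ = Fin.suc (Fin.suc Fin.zero)

module ConjugationProperties {c ℓ} (G : Group c ℓ) where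
  open Group G hiding (refl; sym; trans)
  open Group G using () renaming (sym to ≈-sym; trans to ≈-trans)
  open GroupProperties G
    using (⁻¹-anti-homo-∙; inverseʳ-unique; \\-leftDividesʳ; //-rightDividesˡ; //-rightDividesʳ; ε⁻¹≈ε)
  open import Relation.Binary.Reasoning.Setoid setoid

  conj : Carrier → Carrier → Carrier
  conj h x = h ∙ (x ∙ h ⁻¹)

  conj-congˡ : ∀ {h h'} x → h ≈ h' → conj h x ≈ conj h' x
  conj-congˡ x h≈h' = ∙-cong h≈h' (∙-congˡ (⁻¹-cong h≈h'))

  conj-intertwines : ∀ h x → conj h x ∙ h ≈ h ∙ x
  conj-intertwines h x = ≈-trans (assoc h _ h) (∙-congˡ (//-rightDividesˡ h x))

  conj-homo-∙ : ∀ h x y → conj h (x ∙ y) ≈ conj h x ∙ conj h y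
  conj-homo-∙ h x y = ≈-sym (begin
    conj h x ∙ (h ∙ (y ∙ h ⁻¹))  ≈⟨ assoc _ h _ ⟨
    (conj h x ∙ h) ∙ (y ∙ h ⁻¹)  ≈⟨ ∙-congʳ (conj-intertwines h x) ⟩
    (h ∙ x) ∙ (y ∙ h ⁻¹)         ≈⟨ assoc h x _ ⟩
    h ∙ (x ∙ (y ∙ h ⁻¹))         ≈⟨ ∙-congˡ (assoc x y _) ⟨
    conj h (x ∙ y)               ∎)

  conj-homo-ε : ∀ h → conj h ε ≈ ε
  conj-homo-ε h = ≈-trans (∙-congˡ (identityˡ _)) (inverseʳ h)

  conj-homo-⁻¹ : ∀ h x → conj h (x ⁻¹) ≈ conj h x ⁻¹
  conj-homo-⁻¹ h x = inverseʳ-unique (conj h x) _ (begin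
    conj h x ∙ conj h (x ⁻¹)  ≈⟨ conj-homo-∙ h x _ ⟨
    conj h (x ∙ x ⁻¹)         ≈⟨ ∙-congˡ (∙-congʳ (inverseʳ x)) ⟩
    conj h ε                  ≈⟨ conj-homo-ε h ⟩
    ε                         ∎)

  conj-identity : ∀ x → conj ε x ≈ x
  conj-identity x = begin
    ε ∙ (x ∙ ε ⁻¹)  ≈⟨ identityˡ _ ⟩
    x ∙ ε ⁻¹        ≈⟨ ∙-congˡ ε⁻¹≈ε ⟩
    x ∙ ε           ≈⟨ identityʳ x ⟩
    x               ∎

  conj-conj : ∀ h g x → conj h (conj g x) ≈ conj (h ∙ g) x
  conj-conj h g x = begin
    h ∙ ((g ∙ (x ∙ g ⁻¹)) ∙ h ⁻¹)  ≈⟨ ∙-congˡ (assoc g _ _) ⟩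
    h ∙ (g ∙ ((x ∙ g ⁻¹) ∙ h ⁻¹))  ≈⟨ assoc h g _ ⟨
    (h ∙ g) ∙ ((x ∙ g ⁻¹) ∙ h ⁻¹)  ≈⟨ ∙-congˡ (assoc x _ _) ⟩
    (h ∙ g) ∙ (x ∙ (g ⁻¹ ∙ h ⁻¹))  ≈⟨ ∙-congˡ (∙-congˡ (⁻¹-anti-homo-∙ h g)) ⟨
    conj (h ∙ g) x                 ∎

  conj-inverse : ∀ h x → conj h (conj (h ⁻¹) x) ≈ x
  conj-inverse h x = ≈-trans (conj-conj h (h ⁻¹) x) (≈-trans (conj-congˡ x (inverseʳ h)) (conj-identity x))

  commute-⁻¹ : ∀ {x y} → x ∙ y ≈ y ∙ x → x ∙ y ⁻¹ ≈ y ⁻¹ ∙ x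
  commute-⁻¹ {x} {y} xy≈yx = begin
    x ∙ y ⁻¹                     ≈⟨ \\-leftDividesʳ y _ ⟨
    y ⁻¹ ∙ (y ∙ (x ∙ y ⁻¹))      ≈⟨ ∙-congˡ (assoc y x _) ⟨
    y ⁻¹ ∙ ((y ∙ x) ∙ y ⁻¹)      ≈⟨ ∙-congˡ (∙-congʳ xy≈yx) ⟨
    y ⁻¹ ∙ ((x ∙ y) ∙ y ⁻¹)      ≈⟨ ∙-congˡ (//-rightDividesʳ y x) ⟩
    y ⁻¹ ∙ x                     ∎

module AtLevel (n : ℕ) where
  open Group (W-group n) public
    using (_∙_; ε; _⁻¹; assoc; identityˡ; identityʳ; inverseˡ)
  open GroupProperties (W-group n) public
    using (ε⁻¹≈ε; ⁻¹-involutive; ⁻¹-anti-homo-∙; inverseʳ-unique; \\-leftDividesʳ; //-rightDividesˡ)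
  open ConjugationProperties (W-group n) public

  record IsSubgroup (P : W n → Set) : Set where
    field
      ε-closed  : P ε
      ∙-closed  : ∀ {x y} → P x → P y → P (x ∙ y)
      ⁻¹-closed : ∀ {x} → P x → P (x ⁻¹)

    powℕ-closed : ∀ {g} → P g → ∀ k → P (powℕ n g k)
    powℕ-closed _  zero    = ε-closed
    powℕ-closed Pg (suc k) = ∙-closed Pg (powℕ-closed Pg k)

    powℤ-closed : ∀ {g} → P g → ∀ k → P (powℤ n g k)
    powℤ-closed Pg (+ k)    = powℕ-closed Pg k
    powℤ-closed Pg -[1+ k ] = ⁻¹-closed (powℕ-closed Pg (suc k))

    conj-closed : ∀ {h x} → P h → P x → P (conj h x)
    conj-closed Ph Px = ∙-closed Ph (∙-closed Px (⁻¹-closed Ph))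

  open IsSubgroup public

  a₁a₂a₃≡ε : a₁ n ∙ (a₂ n ∙ a₃ n) ≡ ε
  a₁a₂a₃≡ε = proj₁ (a₁a₂a₃-relations n)

  a₂a₃a₁≡ε : a₂ n ∙ (a₃ n ∙ a₁ n) ≡ ε
  a₂a₃a₁≡ε = proj₁ (proj₂ (a₁a₂a₃-relations n))

  a₃a₁a₂≡ε : a₃ n ∙ (a₁ n ∙ a₂ n) ≡ ε
  a₃a₁a₂≡ε = proj₂ (proj₂ (a₁a₂a₃-relations n))

  evalW-++ : ∀ w w' → evalW n (w ++ w') ≡ evalW n w ∙ evalW n w'
  evalW-++ []            w' = sym (identityˡ _)
  evalW-++ ((i , b) ∷ w) w' = trans (cong (_ ∙_) (evalW-++ w w')) (sym (assoc _ _ _))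

  InG-gen : ∀ i → InG n (gen n i)
  InG-gen i = (i , false) ∷ [] , identityʳ _

  InG-gen⁻¹ : ∀ i → InG n (gen n i ⁻¹)
  InG-gen⁻¹ i = (i , true) ∷ [] , identityʳ _

  InG-isSubgroup : IsSubgroup (InG n)
  InG-isSubgroup = record { ε-closed = [] , refl ; ∙-closed = InG-∙ ; ⁻¹-closed = InG-⁻¹ }
    where
    InG-∙ : ∀ {x y} → InG n x → InG n y → InG n (x ∙ y)
    InG-∙ (w , refl) (w' , refl) = w ++ w' , evalW-++ w w'

    InG-letter⁻¹ : ∀ i b → InG n ((if b then gen n i ⁻¹ else gen n i) ⁻¹)
    InG-letter⁻¹ i false = InG-gen⁻¹ i
    InG-letter⁻¹ i true  = subst (InG n) (sym (⁻¹-involutive _)) (InG-gen i)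

    InG-⁻¹ : ∀ {x} → InG n x → InG n (x ⁻¹)
    InG-⁻¹ ([] , refl)            = [] , sym ε⁻¹≈ε
    InG-⁻¹ ((i , b) ∷ w , refl) =
      subst (InG n) (sym (⁻¹-anti-homo-∙ _ _)) (InG-∙ (InG-⁻¹ (w , refl)) (InG-letter⁻¹ i b))

  InG-least : ∀ {P} → IsSubgroup P → (∀ i → P (gen n i)) → ∀ {x} → InG n x → P x
  InG-least {P} P-sub P-gen (w , refl) = go w
    where
    go : ∀ w → P (evalW n w)
    go []                = ε-closed P-sub
    go ((i , false) ∷ w) = ∙-closed P-sub (P-gen i) (go w)
    go ((i , true)  ∷ w) = ∙-closed P-sub (⁻¹-closed P-sub (P-gen i)) (go w)

  gen⁻¹-positive : ∀ i → Σ (Fin 3) λ j → Σ (Fin 3) λ k → gen n i ⁻¹ ≡ gen n j ∙ gen n k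
  gen⁻¹-positive i₁ = i₂ , i₃ , sym (inverseʳ-unique _ _ a₁a₂a₃≡ε)
  gen⁻¹-positive i₂ = i₃ , i₁ , sym (inverseʳ-unique _ _ a₂a₃a₁≡ε)
  gen⁻¹-positive i₃ = i₁ , i₂ , sym (inverseʳ-unique _ _ a₃a₁a₂≡ε)

  InG-induction : ∀ {P : W n → Set} → P ε → (∀ i {y} → P y → P (gen n i ∙ y)) →
                  ∀ {x} → InG n x → P x
  InG-induction {P} P-ε P-step (w , refl) = go w
    where
    go : ∀ w → P (evalW n w)
    go []                = P-ε
    go ((i , false) ∷ w) = P-step i (go w)
    go ((i , true)  ∷ w) with gen⁻¹-positive i
    ... | j , k , eq = subst P (trans (sym (assoc _ _ _)) (cong (_∙ evalW n w) (sym eq)))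
                               (P-step j (P-step k (go w)))

  a₃^ : Bool → W n
  a₃^ b = if b then a₃ n ⁻¹ else a₃ n

  conjProd-++ : ∀ l l' → conjProd n (l ++ l') ≡ conjProd n l ∙ conjProd n l'
  conjProd-++ []      l' = sym (identityˡ _)
  conjProd-++ (_ ∷ l) l' = trans (cong (_ ∙_) (conjProd-++ l l')) (sym (assoc _ _ _))

  InN3-conj-a₃^ : ∀ w b → InN3 n (conj (evalW n w) (a₃^ b))
  InN3-conj-a₃^ w b = (w , b) ∷ [] , identityʳ _

  InN3-isSubgroup : IsSubgroup (InN3 n)
  InN3-isSubgroup = record { ε-closed = [] , refl ; ∙-closed = InN3-∙ ; ⁻¹-closed = InN3-⁻¹ }
    where
    InN3-∙ : ∀ {x y} → InN3 n x → InN3 n y → InN3 n (x ∙ y)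
    InN3-∙ (l , refl) (l' , refl) = l ++ l' , conjProd-++ l l'

    a₃^-⁻¹ : ∀ b → Σ Bool λ b' → a₃^ b ⁻¹ ≡ a₃^ b'
    a₃^-⁻¹ false = true , refl
    a₃^-⁻¹ true  = false , ⁻¹-involutive _

    InN3-conj-a₃^-⁻¹ : ∀ w b → InN3 n (conj (evalW n w) (a₃^ b) ⁻¹)
    InN3-conj-a₃^-⁻¹ w b with a₃^-⁻¹ b
    ... | b' , eq = subst (InN3 n) (trans (cong (conj _) (sym eq)) (conj-homo-⁻¹ _ _))
                                   (InN3-conj-a₃^ w b')

    InN3-⁻¹ : ∀ {x} → InN3 n x → InN3 n (x ⁻¹)
    InN3-⁻¹ ([] , refl)            = [] , sym ε⁻¹≈ε
    InN3-⁻¹ ((w , b) ∷ l , refl) =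
      subst (InN3 n) (sym (⁻¹-anti-homo-∙ _ _)) (InN3-∙ (InN3-⁻¹ (l , refl)) (InN3-conj-a₃^-⁻¹ w b))

  InN3-least : ∀ {P} → IsSubgroup P → (∀ {g} → InG n g → P (conj g (a₃ n))) →
               ∀ {x} → InN3 n x → P x
  InN3-least {P} P-sub P-conj (l , refl) = go l
    where
    go : ∀ l → P (conjProd n l)
    go []                = ε-closed P-sub
    go ((w , false) ∷ l) = ∙-closed P-sub (P-conj (w , refl)) (go l)
    go ((w , true)  ∷ l) =
      ∙-closed P-sub (subst P (sym (conj-homo-⁻¹ _ _)) (⁻¹-closed P-sub (P-conj (w , refl)))) (go l)

  InN3-conj-a₃ : ∀ {g} → InG n g → InN3 n (conj g (a₃ n))
  InN3-conj-a₃ (w , refl) = InN3-conj-a₃^ w false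

  InN3-normal : ∀ {h x} → InG n h → InN3 n x → InN3 n (conj h x)
  InN3-normal {h} Gh = InN3-least conj-preserves (λ Gg →
      subst (InN3 n) (sym (conj-conj h _ _)) (InN3-conj-a₃ (∙-closed InG-isSubgroup Gh Gg)))
    where

    conj-preserves : IsSubgroup (λ x → InN3 n (conj h x))
    conj-preserves = record
      { ε-closed  = subst (InN3 n) (sym (conj-homo-ε h)) (ε-closed InN3-isSubgroup)
      ; ∙-closed  = λ Nx Ny → subst (InN3 n) (sym (conj-homo-∙ h _ _)) (∙-closed InN3-isSubgroup Nx Ny)
      ; ⁻¹-closed = λ Nx → subst (InN3 n) (sym (conj-homo-⁻¹ h _)) (⁻¹-closed InN3-isSubgroup Nx) }

  InN3-a₃ : InN3 n (a₃ n)
  InN3-a₃ = subst (InN3 n) (conj-identity _) (InN3-conj-a₃ (ε-closed InG-isSubgroup))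

  powℕ-comm : ∀ g k → g ∙ powℕ n g k ≡ powℕ n g k ∙ g
  powℕ-comm g zero    = trans (identityʳ g) (sym (identityˡ g))
  powℕ-comm g (suc k) = trans (cong (g ∙_) (powℕ-comm g k)) (sym (assoc _ _ _))

  powℤ-comm : ∀ g k → g ∙ powℤ n g k ≡ powℤ n g k ∙ g
  powℤ-comm g (+ k)    = powℕ-comm g k
  powℤ-comm g -[1+ k ] = commute-⁻¹ (powℕ-comm g (suc k))

  powℤ-∙-suc : ∀ g k → powℤ n g k ∙ g ≡ powℤ n g (ℤ.suc k)
  powℤ-∙-suc g (+ k)          = sym (powℕ-comm g k)
  powℤ-∙-suc g -[1+ zero ]    = trans (cong (λ x → x ⁻¹ ∙ g) (identityʳ g)) (inverseˡ g)
  powℤ-∙-suc g -[1+ suc k ] =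
    trans (cong (_∙ g) (⁻¹-anti-homo-∙ g _)) (//-rightDividesˡ g _)

  ⁻¹-∙-powℤ-pred : ∀ g k → g ⁻¹ ∙ powℤ n g k ≡ powℤ n g (ℤ.pred k)
  ⁻¹-∙-powℤ-pred g (+ zero)    = trans (identityʳ _) (cong _⁻¹ (sym (identityʳ g)))
  ⁻¹-∙-powℤ-pred g (+ suc k)   = \\-leftDividesʳ g _
  ⁻¹-∙-powℤ-pred g -[1+ k ]    =
    trans (sym (⁻¹-anti-homo-∙ _ g)) (cong _⁻¹ (sym (powℕ-comm g (suc k))))

  infix 4 _∈⟨_⟩
  _∈⟨_⟩ : W n → W n → Set
  c ∈⟨ g ⟩ = ∃ λ k → c ≡ powℤ n g k

  ∈⟨⟩-ε : ∀ {g} → ε ∈⟨ g ⟩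
  ∈⟨⟩-ε = + zero , refl

  ∈⟨⟩-∙ : ∀ {g c} → c ∈⟨ g ⟩ → c ∙ g ∈⟨ g ⟩
  ∈⟨⟩-∙ (k , refl) = ℤ.suc k , powℤ-∙-suc _ k

  ∈⟨⟩-⁻¹∙ : ∀ {g c} → c ∈⟨ g ⟩ → g ⁻¹ ∙ c ∈⟨ g ⟩
  ∈⟨⟩-⁻¹∙ (k , refl) = ℤ.pred k , ⁻¹-∙-powℤ-pred _ k

  ∈⟨⟩-comm : ∀ {g c} → c ∈⟨ g ⟩ → g ∙ c ≡ c ∙ g
  ∈⟨⟩-comm (k , refl) = powℤ-comm _ k

  infix 4 _∼_
  _∼_ : W n → W n → Set
  u ∼ c = Σ (W n) λ p → InN3 n p × u ≡ p ∙ c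

  ∼-reflexive : ∀ {u c} → u ≡ c → u ∼ c
  ∼-reflexive refl = ε , ε-closed InN3-isSubgroup , sym (identityˡ _)

  ∼-trans : ∀ {u v c} → u ∼ v → v ∼ c → u ∼ c
  ∼-trans (p , Np , refl) (q , Nq , refl) = p ∙ q , ∙-closed InN3-isSubgroup Np Nq , sym (assoc p q _)

  ∼-preorder : Preorder 0ℓ 0ℓ 0ℓ
  ∼-preorder = record
    { Carrier = W n ; _≈_ = _≡_ ; _≲_ = _∼_
    ; isPreorder = record { isEquivalence = isEquivalence ; reflexive = ∼-reflexive ; trans = ∼-trans } }

  module ∼-Reasoning = PreorderReasoning ∼-preorder

  ∼-absorbˡ : ∀ {p} u → InN3 n p → p ∙ u ∼ u
  ∼-absorbˡ _ Np = _ , Np , refl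

  ∼-∙ʳ : ∀ {u c} h → u ∼ c → u ∙ h ∼ c ∙ h
  ∼-∙ʳ h (p , Np , refl) = p , Np , assoc p _ h

  ∼-∙ˡ : ∀ {h u c} → InG n h → u ∼ c → h ∙ u ∼ h ∙ c
  ∼-∙ˡ {h} {c = c} Gh (p , Np , refl) = conj h p , InN3-normal Gh Np , (begin
    h ∙ (p ∙ c)         ≡⟨ sym (assoc h p c) ⟩
    (h ∙ p) ∙ c         ≡⟨ cong (_∙ c) (sym (conj-intertwines h p)) ⟩
    (conj h p ∙ h) ∙ c  ≡⟨ assoc _ h c ⟩
    conj h p ∙ (h ∙ c)  ∎)
    where open ≡-Reasoning

  a₂∼a₁⁻¹ : a₂ n ∼ a₁ n ⁻¹
  a₂∼a₁⁻¹ = conj (a₁ n ⁻¹) (a₃ n ⁻¹) , N , (begin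
    a₂ n                            ≡⟨ sym (\\-leftDividesʳ (a₁ n) _) ⟩
    a₁ n ⁻¹ ∙ (a₁ n ∙ a₂ n)         ≡⟨ cong (a₁ n ⁻¹ ∙_) (inverseʳ-unique _ _ a₃a₁a₂≡ε) ⟩
    a₁ n ⁻¹ ∙ a₃ n ⁻¹               ≡⟨ sym (conj-intertwines _ _) ⟩
    conj (a₁ n ⁻¹) (a₃ n ⁻¹) ∙ a₁ n ⁻¹ ∎)
    where
    open ≡-Reasoning
    N : InN3 n (conj (a₁ n ⁻¹) (a₃ n ⁻¹))
    N = InN3-normal (InG-gen⁻¹ i₁) (⁻¹-closed InN3-isSubgroup InN3-a₃)

module NextLevel (n : ℕ) where
  open AtLevel n
  private
    module S = AtLevel (suc n)
    G⁺ = S.InG-isSubgroup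

  pair-≡ : ∀ {u u' v v'} → u ≡ u' → v ≡ v' → _≡_ {A = W (suc n)} (u , v , false) (u' , v' , false)
  pair-≡ = cong₂ (λ u v → u , v , false)

  powℕ-diag : ∀ g k → powℕ (suc n) (g , g , false) k ≡ (powℕ n g k , powℕ n g k , false)
  powℕ-diag g zero    = refl
  powℕ-diag g (suc k) rewrite powℕ-diag g k = refl

  powℤ-diag : ∀ g k → powℤ (suc n) (g , g , false) k ≡ (powℤ n g k , powℤ n g k , false)
  powℤ-diag g (+ k)    = powℕ-diag g k
  powℤ-diag g -[1+ k ] = cong (inv (suc n)) (powℕ-diag g (suc k))

  InG-diag-a₁ : InG (suc n) (a₁ n , a₁ n , false)
  InG-diag-a₁ = subst (InG (suc n)) (pair-≡ (identityˡ _) (identityʳ _))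
                      (S.∙-closed G⁺ (S.InG-gen i₂) (S.InG-gen i₂))

  InG-diag-a₂ : InG (suc n) (a₂ n , a₂ n , false)
  InG-diag-a₂ = subst (InG (suc n)) (pair-≡ (identityʳ _) (identityˡ _))
                      (S.∙-closed G⁺ (S.InG-gen i₃) (S.InG-gen i₃))

  InG-lift : ∀ {g} → InG n g → Σ (W n) λ h → InG (suc n) (h , g , false)
  InG-lift = InG-least lift-isSubgroup λ where
      i₁ → a₁ n , InG-diag-a₁
      i₂ → a₂ n , InG-diag-a₂
      i₃ → ε , S.InG-gen i₁
    where
    lift-isSubgroup : IsSubgroup (λ g → Σ (W n) λ h → InG (suc n) (h , g , false))
    lift-isSubgroup = record
      { ε-closed  = ε , S.ε-closed G⁺
      ; ∙-closed  = λ (h , Gh) (h' , Gh') → h ∙ h' , S.∙-closed G⁺ Gh Gh'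
      ; ⁻¹-closed = λ (h , Gh) → h ⁻¹ , S.⁻¹-closed G⁺ Gh }

  InG-second : ∀ {q} → InN3 n q → InG (suc n) (ε , q , false)
  InG-second = InN3-least second-isSubgroup λ Gg →
      let h , Gh = InG-lift Gg
      in subst (InG (suc n)) (pair-≡ (conj-homo-ε h) refl) (S.conj-closed G⁺ Gh (S.InG-gen i₁))
    where
    second-isSubgroup : IsSubgroup (λ q → InG (suc n) (ε , q , false))
    second-isSubgroup = record
      { ε-closed  = S.ε-closed G⁺
      ; ∙-closed  = λ Gq Gq' → subst (InG (suc n)) (pair-≡ (identityˡ ε) refl) (S.∙-closed G⁺ Gq Gq')
      ; ⁻¹-closed = λ Gq → subst (InG (suc n)) (pair-≡ ε⁻¹≈ε refl) (S.⁻¹-closed G⁺ Gq) }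

  InG-first : ∀ {p} → InN3 n p → InG (suc n) (p , ε , false)
  InG-first Np = subst (InG (suc n)) (pair-≡ (conj-inverse (a₂ n) _) (conj-homo-ε ε))
    (S.conj-closed G⁺ (S.InG-gen i₃) (InG-second (InN3-normal (InG-gen⁻¹ i₂) Np)))

  InG-pair : ∀ {p q} → InN3 n p → InN3 n q → InG (suc n) (p , q , false)
  InG-pair Np Nq = subst (InG (suc n)) (pair-≡ (identityʳ _) (identityˡ _))
                         (S.∙-closed G⁺ (InG-first Np) (InG-second Nq))

  InProd⇒InG : ∀ {x} → InProd n x → InG (suc n) x × InLevel1Stab n x
  InProd⇒InG (p , q , k , Np , Nq , refl) =
    S.∙-closed G⁺ (InG-pair Np Nq) (S.powℤ-closed G⁺ InG-diag-a₁ k) , stabilises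
    where
    stabilises : InLevel1Stab n (comp (suc n) (p , q , false) (powℤ (suc n) (a₁ n , a₁ n , false) k))
    stabilises rewrite powℤ-diag (a₁ n) k = refl

  -- Membership in H ∪ H a₂: with c = a₁ᵏ, (p c , q c , false) = (p , q)(a₁ , a₁)ᵏ and
  -- (p c , q c a₁ , true) = (p , q)(a₁ , a₁)ᵏ a₂.
  InH∪Ha₂ : W (suc n) → Set
  InH∪Ha₂ (u , v , s) = Σ (W n) λ c → c ∈⟨ a₁ n ⟩ × u ∼ c × v ∼ (if s then c ∙ a₁ n else c)

  a₁∙-∼ : ∀ {u c} → c ∈⟨ a₁ n ⟩ → u ∼ c → a₁ n ∙ u ∼ c ∙ a₁ n
  a₁∙-∼ {u} {c} c∈ u∼c = begin
    a₁ n ∙ u  ∼⟨ ∼-∙ˡ (InG-gen i₁) u∼c ⟩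
    a₁ n ∙ c  ≡⟨ ∈⟨⟩-comm c∈ ⟩
    c ∙ a₁ n  ∎
    where open ∼-Reasoning

  a₂∙-∼ : ∀ {v d} → v ∼ d → a₂ n ∙ v ∼ a₁ n ⁻¹ ∙ d
  a₂∙-∼ {v} {d} v∼d = begin
    a₂ n ∙ v     ∼⟨ ∼-∙ʳ v a₂∼a₁⁻¹ ⟩
    a₁ n ⁻¹ ∙ v  ∼⟨ ∼-∙ˡ (InG-gen⁻¹ i₁) v∼d ⟩
    a₁ n ⁻¹ ∙ d  ∎
    where open ∼-Reasoning

  a₁⁻¹∙c∙a₁≡c : ∀ {c} → c ∈⟨ a₁ n ⟩ → a₁ n ⁻¹ ∙ (c ∙ a₁ n) ≡ c
  a₁⁻¹∙c∙a₁≡c c∈ = trans (cong (a₁ n ⁻¹ ∙_) (sym (∈⟨⟩-comm c∈))) (\\-leftDividesʳ (a₁ n) _)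

  ε∙-∼ : ∀ {u c} → u ∼ c → ε ∙ u ∼ c
  ε∙-∼ {u} = ∼-trans (∼-absorbˡ u (ε-closed InN3-isSubgroup))

  InH∪Ha₂-a₁∙ : ∀ {y} → InH∪Ha₂ y → InH∪Ha₂ (a₁ (suc n) S.∙ y)
  InH∪Ha₂-a₁∙ {u , v , _} (c , c∈ , u∼c , v∼c′) =
    c , c∈ , ε∙-∼ u∼c , ∼-trans (∼-absorbˡ v InN3-a₃) v∼c′

  InH∪Ha₂-a₂∙ : ∀ {y} → InH∪Ha₂ y → InH∪Ha₂ (a₂ (suc n) S.∙ y)
  InH∪Ha₂-a₂∙ {u , v , false} (c , c∈ , u∼c , v∼c)  = c , c∈ , ε∙-∼ v∼c , a₁∙-∼ c∈ u∼c
  InH∪Ha₂-a₂∙ {u , v , true}  (c , c∈ , u∼c , v∼c′) = c ∙ a₁ n , ∈⟨⟩-∙ c∈ , ε∙-∼ v∼c′ , a₁∙-∼ c∈ u∼c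

  InH∪Ha₂-a₃∙ : ∀ {y} → InH∪Ha₂ y → InH∪Ha₂ (a₃ (suc n) S.∙ y)
  InH∪Ha₂-a₃∙ {u , v , false} (c , c∈ , u∼c , v∼c) =
    a₁ n ⁻¹ ∙ c , ∈⟨⟩-⁻¹∙ c∈ , a₂∙-∼ v∼c , (begin
      ε ∙ u                 ∼⟨ ε∙-∼ u∼c ⟩
      c                     ≡⟨ sym (a₁⁻¹∙c∙a₁≡c c∈) ⟩
      a₁ n ⁻¹ ∙ (c ∙ a₁ n)  ≡⟨ sym (assoc _ c _) ⟩
      a₁ n ⁻¹ ∙ c ∙ a₁ n    ∎)
    where open ∼-Reasoning
  InH∪Ha₂-a₃∙ {u , v , true} (c , c∈ , u∼c , v∼c′) =
    c , c∈ , ∼-trans (a₂∙-∼ v∼c′) (∼-reflexive (a₁⁻¹∙c∙a₁≡c c∈)) , ε∙-∼ u∼c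

  InG⇒InH∪Ha₂ : ∀ {y} → InG (suc n) y → InH∪Ha₂ y
  InG⇒InH∪Ha₂ = S.InG-induction (ε , ∈⟨⟩-ε , ∼-reflexive refl , ∼-reflexive refl) λ where
    i₁ {y} → InH∪Ha₂-a₁∙ {y}
    i₂ {y} → InH∪Ha₂-a₂∙ {y}
    i₃ {y} → InH∪Ha₂-a₃∙ {y}

  InG⇒InProd : ∀ {x} → InG (suc n) x → InLevel1Stab n x → InProd n x
  InG⇒InProd {u , v , false} Gx refl with InG⇒InH∪Ha₂ Gx
  ... | _ , (k , refl) , (p , Np , refl) , (q , Nq , refl) =
    p , q , k , Np , Nq , sym (cong (comp (suc n) (p , q , false)) (powℤ-diag (a₁ n) k))

lemma7p13 : (m : ℕ) → 1 ≤ m → (x : W (suc m)) →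
    (InG (suc m) x × InLevel1Stab m x) ⇔ InProd m x
lemma7p13 m _ x = mk⇔ (λ (Gx , stab) → InG⇒InProd Gx stab) InProd⇒InG
  where open NextLevel m
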